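{- For every formula $A$ of $\mathsf{LTL}^{\ll}$, the formula $\top \mathbin{\sim} A$ is equivalent to the formula $\Diamond\Box A$; that is, for every model $\sigma$ and every natural number $i$, we have $\sigma, i \models \top \mathbin{\sim} A$ if and only if $\sigma, i \models \Diamond \Box A$.
   Context: Fix a set $\mathsf{Prop}$ of atomic propositions. Formulas of $\mathsf{LTL}^{\ll}$ are built inductively: each $P\in\mathsf{Prop}$ is a formula; if $A,B$ are formulas then so are $\lnot A$, $A\land B$, $\mathsf{X}A$, $A \mathbin{\mathsf{U}} B$ and $A \mathbin{\ll} B$. Other Boolean connectives ($\lor$ etc.) are defined as usual. Set $\top := P\lor\lnot P$ for a fixed atomic proposition $P$, $\Diamond B := \top \mathbin{\mathsf{U}} B$, $\Box B := \lnot\Diamond\lnot B$, and $A \mathbin{\sim} B := \lnot(A\mathbin{\ll} B)\land\lnot(B\mathbin{\ll} A)$. A model $\sigma$ is an infinite sequence $\sigma_0\sigma_1\sigma_2\ldots$ of subsets of $\mathsf{Prop}$. Satisfaction $\sigma,i\models\cdot$ (for $i\in\mathbb{N}$) is defined by: $\sigma,i\models P$ iff $P\in\sigma_i$; $\sigma,i\models\lnot A$ iff not $\sigma,i\models A$; $\sigma,i\models A\land B$ iff both hold; $\sigma,i\models \mathsf{X}A$ iff $\sigma,i+1\models A$; $\sigma,i\models A\mathbin{\mathsf{U}}B$ iff there is $j\ge i$ with $\sigma,j\models B$ and $\sigma,k\models A$ for all $i\le k<j$; and $\sigma,i\models A\mathbin{\ll}B$ iff for every $b$ there exists $j$ such that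 $\mathsf{card}(A_\sigma^{i,j})+b\le \mathsf{card}(B_\sigma^{i,j})$, where $A_\sigma^{i,j}:=\{k\in\mathbb{N} : i\le k\le j \text{ and } \sigma,k\models A\}$ and $\mathsf{card}$ denotes cardinality. -}

module Defs where

open import Data.Nat using (ℕ; zero; suc; _+_; _∸_; _≤_)
open import Data.Product using (Σ; ∃; _×_; _,_)
open import Relation.Nullary using (¬_)

data Formula (Atom : Set) : Set where
  atom : Atom → Formula Atom
  ~_   : Formula Atom → Formula Atom
  _∧_  : Formula Atom → Formula Atom → Formula Atom
  X_   : Formula Atom → Formula Atom
  _U_  : Formula Atom → Formula Atom → Formula Atom
  _≪_  : Formula Atom → Formula Atom → Formula Atom

module _ {Atom : Set} where

  _∨_ : Formula Atom → Formula Atom → Formula Atom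
  A ∨ B = ~ ((~ A) ∧ (~ B))

  ⊤F : Atom → Formula Atom
  ⊤F P = atom P ∨ (~ atom P)

  ◇ : Atom → Formula Atom → Formula Atom
  ◇ P B = ⊤F P U B

  □ : Atom → Formula Atom → Formula Atom
  □ P B = ~ (◇ P (~ B))

  _∼_ : Formula Atom → Formula Atom → Formula Atom
  A ∼ B = (~ (A ≪ B)) ∧ (~ (B ≪ A))

Model : Set → Set₁
Model Atom = ℕ → Atom → Set

-- CountFrom Q i l n : the set {k | i ≤ k < i + l, Q k} has exactly n elements.
data CountFrom (Q : ℕ → Set) : ℕ → ℕ → ℕ → Set where
  cnt-nil  : ∀ {i} → CountFrom Q i zero zero
  cnt-yes  : ∀ {i l n} → Q i → CountFrom Q (suc i) l n → CountFrom Q i (suc l) (suc n)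
  cnt-no   : ∀ {i l n} → ¬ Q i → CountFrom Q (suc i) l n → CountFrom Q i (suc l) n

-- Card Q i j n : card {k ∈ ℕ | i ≤ k ≤ j and Q k} = n   (empty when j < i)
Card : (ℕ → Set) → ℕ → ℕ → ℕ → Set
Card Q i j n = CountFrom Q i (suc j ∸ i) n

_,_⊨_ : {Atom : Set} → Model Atom → ℕ → Formula Atom → Set
σ , i ⊨ atom P = σ i P
σ , i ⊨ (~ A) = ¬ (σ , i ⊨ A)
σ , i ⊨ (A ∧ B) = (σ , i ⊨ A) × (σ , i ⊨ B)
σ , i ⊨ (X A) = σ , suc i ⊨ A
σ , i ⊨ (A U B) = Σ ℕ λ j → i ≤ j × (σ , j ⊨ B) × (∀ k → i ≤ k → suc k ≤ j → σ , k ⊨ A)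
σ , i ⊨ (A ≪ B) = ∀ (b : ℕ) → Σ ℕ λ j → Σ ℕ λ m → Σ ℕ λ n →
  Card (λ k → σ , k ⊨ A) i j m × Card (λ k → σ , k ⊨ B) i j n × m + b ≤ n

-- A ≪ ⊤ says that the number of positions where A fails, within windows starting at i,
-- is unbounded, i.e. that A fails infinitely often; ⊤ ≪ A is never true. Hence ⊤ ∼ A
-- says that A fails only finitely often, which is what ◇□A says. The direction from
-- "A fails infinitely often" to an unboundedly large deficit needs excluded middle,
-- both to count the positions of A in a window and to turn ¬◇□A into infinitely many
-- failures of A.
module Submission where

open import Defs
open import Level using (0ℓ)
open import Axiom.ExcludedMiddle using (ExcludedMiddle)
open import Data.Nat using (ℕ; zero; suc; _+_; _∸_; _≤_; z≤n; s≤s)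
open import Data.Nat.Properties
open import Data.Nat.Solver using (module +-*-Solver)
open import Data.Product using (_×_; ∃; ∃₂; _,_)
open import Relation.Nullary using (¬_; yes; no; contradiction)
open import Function using (_∘_)
open import Relation.Nullary.Decidable using (decidable-stable)
open import Relation.Binary.PropositionalEquality
open +-*-Solver using (solve; _:=_; _:+_; con)

miss-position : ∀ l d i → suc l + d + i ≡ d + (suc l + i)
miss-position = solve 3 (λ l d i → con 1 :+ l :+ d :+ i := d :+ (con 1 :+ l :+ i)) refl

deficit-grows : ∀ {n b l n₁ d} → n + b ≤ suc l → n₁ ≤ d → n + n₁ + 0 + suc b ≤ suc (l + d + 1)
deficit-grows {n} {b} {l} {n₁} {d} n+b≤ n₁≤d =
  subst (_≤ suc (l + d + 1)) (lemma n b n₁) (+-monoˡ-≤ 1 (+-mono-≤ n+b≤ n₁≤d))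
  where
  lemma : ∀ n b n₁ → n + b + n₁ + 1 ≡ n + n₁ + 0 + suc b
  lemma = solve 3 (λ n b n₁ → n :+ b :+ n₁ :+ con 1 := n :+ n₁ :+ con 0 :+ (con 1 :+ b)) refl

InfinitelyOften : (ℕ → Set) → Set
InfinitelyOften Q = ∀ c → ∃ λ d → Q (d + c)

module _ {Q : ℕ → Set} where

  count≤length : ∀ {i l n} → CountFrom Q i l n → n ≤ l
  count≤length cnt-nil       = z≤n
  count≤length (cnt-yes _ c) = s≤s (count≤length c)
  count≤length (cnt-no _ c)  = m≤n⇒m≤1+n (count≤length c)

  count-all : (∀ k → Q k) → ∀ i l → CountFrom Q i l l
  count-all q i zero    = cnt-nil
  count-all q i (suc l) = cnt-yes (q i) (count-all q (suc i) l)

  reindex : ∀ {i j l n} → i ≡ j → CountFrom Q i l n → CountFrom Q j l n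
  reindex refl c = c

  count-++ : ∀ {i l₁ l₂ n₁ n₂} →
    CountFrom Q i l₁ n₁ → CountFrom Q (l₁ + i) l₂ n₂ → CountFrom Q i (l₁ + l₂) (n₁ + n₂)
  count-++ cnt-nil c = c
  count-++ {i} (cnt-yes {l = l} q c) c′ = cnt-yes q (count-++ c (reindex (sym (+-suc l i)) c′))
  count-++ {i} (cnt-no {l = l} ¬q c) c′ = cnt-no ¬q (count-++ c (reindex (sym (+-suc l i)) c′))

  length≤count+ : ∀ g {i l n} → (∀ k → g + i ≤ k → ¬ ¬ Q k) → CountFrom Q i l n → l ≤ n + g
  length≤count+ g       q cnt-nil = z≤n
  length≤count+ g {i}   q (cnt-yes _ c) =
    s≤s (length≤count+ g (λ k le → q k (≤-trans (+-monoʳ-≤ g (n≤1+n i)) le)) c)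
  length≤count+ zero    q (cnt-no ¬q c) = contradiction ¬q (q _ ≤-refl)
  length≤count+ (suc g) {i} {n = n} q (cnt-no _ c) = begin
    suc _           ≤⟨ s≤s (length≤count+ g (λ k le → q k (subst (_≤ k) (+-suc g i) le)) c) ⟩
    suc (n + g)     ≡⟨ sym (+-suc n g) ⟩
    n + suc g       ∎
    where open ≤-Reasoning

  count⇒Card : ∀ {i l n} → CountFrom Q i (suc l) n → Card Q i (l + i) n
  count⇒Card {i} {l} {n} = subst (λ L → CountFrom Q i L n) (sym (m+n∸n≡m (suc l) i))

  module _ (em : ExcludedMiddle 0ℓ) where

    count-exists : ∀ i l → ∃ (CountFrom Q i l)
    count-exists i zero = 0 , cnt-nil
    count-exists i (suc l) with count-exists (suc i) l | em {Q i}
    ... | n , c | yes q = suc n , cnt-yes q c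
    ... | n , c | no ¬q = n , cnt-no ¬q c

    deficit-unbounded : InfinitelyOften (λ k → ¬ Q k) → ∀ i b →
      ∃₂ λ l n → CountFrom Q i (suc l) n × n + b ≤ suc l
    deficit-unbounded _ i zero =
      let n , c = count-exists i 1 in 0 , n , c , subst (_≤ 1) (sym (+-identityʳ n)) (count≤length c)
    deficit-unbounded io i (suc b) = grow (deficit-unbounded io i b)
      where
      -- Extend the window up to the next failure of Q after it: the gap adds at most
      -- its length to the count, and the failure itself adds one to the deficit.
      grow : (∃₂ λ l n → CountFrom Q i (suc l) n × n + b ≤ suc l) →
             ∃₂ λ l n → CountFrom Q i (suc l) n × n + suc b ≤ suc l
      grow (l , n , c , n+b≤) =
        let d , ¬q    = io (suc l + i)
            n₁ , gap = count-exists (suc l + i) d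
            miss     = cnt-no (¬q ∘ subst Q (miss-position l d i)) cnt-nil
        in  l + d + 1 , n + n₁ + 0 , count-++ (count-++ c gap) miss ,
            deficit-grows n+b≤ (count≤length gap)

module _ {Atom : Set} (σ : Model Atom) where

  ⊤-valid : ∀ (P : Atom) k → σ , k ⊨ ⊤F P
  ⊤-valid P k (¬p , ¬¬p) = ¬¬p ¬p

  eventually⇒¬≪ : ∀ (A B : Formula Atom) {i} g →
    (∀ k → g + i ≤ k → ¬ ¬ (σ , k ⊨ A)) → ¬ (σ , i ⊨ (A ≪ B))
  eventually⇒¬≪ A B {i} g A-from-g A≪B =
    let j , m , n , cA , cB , m+1+g≤n = A≪B (suc g)
    in  n≮n (m + g) (begin-strict
          m + g        <⟨ ≤-reflexive (sym (+-suc m g)) ⟩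
          m + suc g    ≤⟨ m+1+g≤n ⟩
          n            ≤⟨ count≤length cB ⟩
          suc j ∸ i    ≤⟨ length≤count+ g A-from-g cA ⟩
          m + g        ∎)
    where open ≤-Reasoning

  infinitely-often-not⇒≪ : ExcludedMiddle 0ℓ → ∀ (A B : Formula Atom) {i} →
    (∀ k → σ , k ⊨ B) → InfinitelyOften (λ k → ¬ (σ , k ⊨ A)) → σ , i ⊨ (A ≪ B)
  infinitely-often-not⇒≪ em A B {i} B-valid ¬A-often b =
    let l , m , cA , m+b≤ = deficit-unbounded em ¬A-often i b
    in  l + i , m , suc l , count⇒Card cA , count⇒Card (count-all B-valid i (suc l)) , m+b≤

  □⇒always : ∀ (P : Atom) A {c} → σ , c ⊨ □ P A → ∀ k → c ≤ k → ¬ ¬ (σ , k ⊨ A)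
  □⇒always P A □A k c≤k ¬A = □A (k , c≤k , ¬A , λ k′ _ _ → ⊤-valid P k′)

  ◇□⇒eventually : ∀ (P : Atom) A {i} → σ , i ⊨ ◇ P (□ P A) →
    ∃ λ g → ∀ k → g + i ≤ k → ¬ ¬ (σ , k ⊨ A)
  ◇□⇒eventually P A {i} (c , i≤c , □A , _) =
    c ∸ i , λ k le → □⇒always P A □A k (subst (_≤ k) (m∸n+n≡m i≤c) le)

  ¬◇□⇒infinitely-often-not : ExcludedMiddle 0ℓ → ∀ (P : Atom) A {i} →
    ¬ (σ , i ⊨ ◇ P (□ P A)) → InfinitelyOften (λ k → ¬ (σ , k ⊨ A))
  ¬◇□⇒infinitely-often-not em P A {i} ¬◇□A c =
    decidable-stable em λ ¬often → ¬◇□A (c + i , m≤n+m i c , □A ¬often , λ k _ _ → ⊤-valid P k)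
    where
    □A : ¬ (∃ λ d → ¬ (σ , d + c ⊨ A)) → σ , c + i ⊨ □ P A
    □A ¬often (k , c+i≤k , ¬A , _) =
      ¬often (k ∸ c , subst (λ j → ¬ (σ , j ⊨ A)) (sym (m∸n+n≡m (m+n≤o⇒m≤o c c+i≤k))) ¬A)

mainTheorem1 : ExcludedMiddle 0ℓ →
    {Atom : Set} (P : Atom) (A : Formula Atom) (σ : Model Atom) (i : ℕ) →
      ((σ , i ⊨ (⊤F P ∼ A)) → (σ , i ⊨ ◇ P (□ P A)))
      × ((σ , i ⊨ ◇ P (□ P A)) → (σ , i ⊨ (⊤F P ∼ A)))
mainTheorem1 em P A σ i = ⊤∼A⇒◇□A , ◇□A⇒⊤∼A
  where
  ⊤∼A⇒◇□A : σ , i ⊨ (⊤F P ∼ A) → σ , i ⊨ ◇ P (□ P A)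
  ⊤∼A⇒◇□A (_ , ¬A≪⊤) = decidable-stable em λ ¬◇□A →
    ¬A≪⊤ (infinitely-often-not⇒≪ σ em A (⊤F P) (⊤-valid σ P) (¬◇□⇒infinitely-often-not σ em P A ¬◇□A))

  ◇□A⇒⊤∼A : σ , i ⊨ ◇ P (□ P A) → σ , i ⊨ (⊤F P ∼ A)
  ◇□A⇒⊤∼A ◇□A =
    let g , A-from-g = ◇□⇒eventually σ P A ◇□A
    in  eventually⇒¬≪ σ (⊤F P) A 0 (λ k _ ¬⊤ → ¬⊤ (⊤-valid σ P k)) , eventually⇒¬≪ σ A (⊤F P) g A-from-g
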